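{- Let $(S,\to)$ and $(S',\to')$ be transition systems, let $\sim\ \subseteq S\times S'$, let $\trianglelefteq$ be a binary relation on $S$ and $\trianglelefteq'$ a binary relation on $S'$, let $\phi$ be a predicate on $S$ and $\phi'$ a predicate on $S'$, and let $I\subseteq S$. Assume: (0) $\to$ simulates $\to'$ via the converse of $\sim$: for all $s\in S$, $s',t'\in S'$, if $s\sim s'$ and $s'\to' t'$ then there is $t\in S$ with $s\to t$ and $t\sim t'$; (1) $\trianglelefteq'$ simulates $\trianglelefteq$ with $\sim$: for all $s,t\in S$, $s'\in S'$, if $s\sim s'$ and $s\trianglelefteq t$ then there is $t'\in S'$ with $s'\trianglelefteq' t'$ and $t\sim t'$; (2) for all $s,t\in S$ and $s',t'\in S'$, if $s\sim s'$, $t\sim t'$ and $s'\trianglelefteq' t'$, then $s\trianglelefteq t$; (3) for all $s\in S$, $s'\in S'$, if $s\sim s'$ and $\phi'(s')$ then $\phi(s)$. Let $I':=\{s'\in S'\mid\exists s\in I.\ s\sim s'\}$. Then: (a) If for all $s\in I$ and $t\in S$ with $s\to t$ there exists $r\in I$ with $t\trianglelefteq r$, then for all $s'\in I'$ and $t'\in S'$ with $s'\to' t'$ there exists $r'\in I'$ with $t'\trianglelefteq' r'$. (b) Let $f:I\to\mathbb{Z}$ satisfy: for all $s,r\in I$ and $t\in S$ with $s\to t$ and $t\trianglelefteq r$, $f(s)\ge f(r)$, and if moreover $\phi(s)$ then $f(s)>f(r)$. Assume that for each $s'\in I'$ the minimum $f'(s'):=\min\{f(s)\mid s\in I\wedge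 s\sim s'\}$ exists (e.g. if $I$ is finite). Then for all $s',r'\in I'$ and $t'\in S'$ with $s'\to' t'$ and $t'\trianglelefteq' r'$, $f'(s')\ge f'(r')$, and if moreover $\phi'(s')$ then $f'(s')>f'(r')$.
   Context: A transition system $(S,\to)$ is a set $S$ with a relation $\to\subseteq S\times S$. -}

module Defs where

open import Data.Product using (Σ; _×_; ∃)
open import Data.Integer using (ℤ; _≤_)
open import Relation.Binary.PropositionalEquality using (_≡_)

Image : {S S' : Set} → (S → S' → Set) → (S → Set) → S' → Set
Image {S} _∼_ I s' = Σ S λ s → I s × (s ∼ s')

IsMinOver : {S S' : Set} → (S → S' → Set) → (I : S → Set) →
            ((s : S) → I s → ℤ) → S' → ℤ → Set
IsMinOver {S} _∼_ I f s' m =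
  (Σ S λ s → Σ (I s) λ i → (s ∼ s') × (f s i ≡ m))
  × ((s : S) (i : I s) → s ∼ s' → m ≤ f s i)

module Submission where

open import Defs
open import Data.Product using (Σ; _×_; _,_; proj₁)
open import Data.Integer using (ℤ; _≤_; _<_)
open import Relation.Binary.PropositionalEquality using (subst₂)

-- Every ⟶'-step out of an image state is mirrored by a ⟶-step out of any ∼-preimage of it.
-- For (a) the mirrored step is covered in I and the covering ⊴-step is pushed forward by (1);
-- for (b) the ⊴'-step is pulled back by (2), so f' inherits the descent of f between the
-- states attaining f'.

CoveredBy : {S : Set} → (S → S → Set) → (S → S → Set) → (S → Set) → Set
CoveredBy {S} _⟶_ _⊴_ I = (s : S) → I s → (t : S) → s ⟶ t → Σ S λ r → I r × (t ⊴ r)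

Ranking : {S : Set} → (S → S → Set) → (S → S → Set) → (S → Set) →
          (I : S → Set) → ((s : S) → I s → ℤ) → Set
Ranking {S} _⟶_ _⊴_ φ I f =
  (s r t : S) (is : I s) (ir : I r) → s ⟶ t → t ⊴ r →
  (f r ir ≤ f s is) × (φ s → f r ir < f s is)

module _ {S S' : Set}
  {_⟶_ : S → S → Set} {_⟶'_ : S' → S' → Set} {_∼_ : S → S' → Set}
  {_⊴_ : S → S → Set} {_⊴'_ : S' → S' → Set} {I : S → Set}
  (back : (s : S) (s' t' : S') → s ∼ s' → s' ⟶' t' → Σ S λ t → (s ⟶ t) × (t ∼ t'))
  where

  covered-image :
    ((s t : S) (s' : S') → s ∼ s' → s ⊴ t → Σ S' λ t' → (s' ⊴' t') × (t ∼ t')) →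
    CoveredBy _⟶_ _⊴_ I → CoveredBy _⟶'_ _⊴'_ (Image _∼_ I)
  covered-image forth covered s' (s , is , s∼s') t' s'⟶t'
    with back s s' t' s∼s' s'⟶t'
  ... | t , s⟶t , t∼t' with covered s is t s⟶t
  ... | r , ir , t⊴r with forth t r t' t∼t' t⊴r
  ... | r' , t'⊴r' , r∼r' = r' , (r , ir , r∼r') , t'⊴r'

  step-⊴-reflected :
    ((s t : S) (s' t' : S') → s ∼ s' → t ∼ t' → s' ⊴' t' → s ⊴ t) →
    {s r : S} {s' t' r' : S'} → s ∼ s' → r ∼ r' → s' ⟶' t' → t' ⊴' r' →
    Σ S λ t → (s ⟶ t) × (t ⊴ r)
  step-⊴-reflected reflect {s} {r} {s'} {t'} {r'} s∼s' r∼r' s'⟶t' t'⊴r'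
    with back s s' t' s∼s' s'⟶t'
  ... | t , s⟶t , t∼t' = t , s⟶t , reflect t r t' r' t∼t' r∼r' t'⊴r'

  ranking-image :
    ((s t : S) (s' t' : S') → s ∼ s' → t ∼ t' → s' ⊴' t' → s ⊴ t) →
    {φ : S → Set} {φ' : S' → Set} → ((s : S) (s' : S') → s ∼ s' → φ' s' → φ s) →
    (f : (s : S) → I s → ℤ) → Ranking _⟶_ _⊴_ φ I f →
    (f' : S' → ℤ) → ((s' : S') → Image _∼_ I s' → IsMinOver _∼_ I f s' (f' s')) →
    Ranking _⟶'_ _⊴'_ φ' (Image _∼_ I) (λ s' _ → f' s')
  ranking-image reflect φ-reflect f ranking f' min s' r' t' is' ir' s'⟶t' t'⊴r'
    with proj₁ (min s' is') | proj₁ (min r' ir')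
  ... | s , is , s∼s' , fs≡ | r , ir , r∼r' , fr≡
    with step-⊴-reflected reflect s∼s' r∼r' s'⟶t' t'⊴r'
  ... | t , s⟶t , t⊴r with ranking s r t is ir s⟶t t⊴r
  ... | fr≤fs , fr<fs =
    subst₂ _≤_ fr≡ fs≡ fr≤fs ,
    λ φ's' → subst₂ _<_ fr≡ fs≡ (fr<fs (φ-reflect s s' s∼s' φ's'))

theorem5 : {S S' : Set}
    (_⟶_ : S → S → Set) (_⟶'_ : S' → S' → Set)
    (_∼_ : S → S' → Set)
    (_⊴_ : S → S → Set) (_⊴'_ : S' → S' → Set)
    (φ : S → Set) (φ' : S' → Set)
    (I : S → Set) →
    ((s : S) (s' t' : S') → s ∼ s' → s' ⟶' t' → Σ S λ t → (s ⟶ t) × (t ∼ t')) →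
    ((s t : S) (s' : S') → s ∼ s' → s ⊴ t → Σ S' λ t' → (s' ⊴' t') × (t ∼ t')) →
    ((s t : S) (s' t' : S') → s ∼ s' → t ∼ t' → s' ⊴' t' → s ⊴ t) →
    ((s : S) (s' : S') → s ∼ s' → φ' s' → φ s) →
    (((s : S) → I s → (t : S) → s ⟶ t → Σ S λ r → I r × (t ⊴ r)) →
      (s' : S') → Image _∼_ I s' → (t' : S') → s' ⟶' t' →
      Σ S' λ r' → Image _∼_ I r' × (t' ⊴' r'))
    ×
    ((f : (s : S) → I s → ℤ) →
      ((s r t : S) (is : I s) (ir : I r) → s ⟶ t → t ⊴ r →
        (f r ir ≤ f s is) × (φ s → f r ir < f s is)) →
      (f' : S' → ℤ) →
      ((s' : S') → Image _∼_ I s' → IsMinOver _∼_ I f s' (f' s')) →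
      (s' r' t' : S') → Image _∼_ I s' → Image _∼_ I r' →
      s' ⟶' t' → t' ⊴' r' →
      (f' r' ≤ f' s') × (φ' s' → f' r' < f' s'))
theorem5 _ _ _ _ _ _ _ _ back forth reflect φ-reflect =
  covered-image back forth , ranking-image back reflect φ-reflect
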